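{- A path $\mu\in J(\Phi^+_{B_n})$ lies in $\mathsf{Pop}^{\uparrow}_{J(\Phi^+_{B_n})}(J(\Phi^+_{B_n}))$ if and only if $\mu$ contains no four consecutive steps $f f r r$ and the only lattice points of $\mu$ on the $x$-axis are $(0,0)$ and $(4n,0)$.
   Context: A Dyck path of semilength $2n$ is a lattice path from $(0,0)$ to $(4n,0)$ with steps $r=(1,1)$ (rise) and $f=(1,-1)$ (fall) never going below the $x$-axis. $J(\Phi^+_{B_n})$ (the lattice of order ideals of the type $B_n$ root poset) is realized as the set of Dyck paths of semilength $2n$ that are symmetric about the line $x=2n$, ordered by $\mu\le\nu$ iff $\mu$ lies weakly below $\nu$; this is a distributive lattice. For a finite lattice $M$ and $x\in M$, $\mathsf{Pop}^{\uparrow}_M(x)$ is the join of $x$ together with all elements covering $x$, and $\mathsf{Pop}^{\uparrow}_M(M)$ is its image. -}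

module Defs where

open import Data.Nat using (ℕ; _*_; _<_; _≤_)
open import Data.Integer as ℤ using (ℤ)
open import Data.List using (List; []; _∷_; _++_; length; take; reverse; map)
open import Data.Product using (Σ; ∃; _×_)
open import Data.Sum using (_⊎_)
open import Relation.Nullary using (¬_)
open import Relation.Binary.PropositionalEquality using (_≡_; _≢_)

-- Steps of a lattice path: r = (1,1) rise, f = (1,-1) fall.
data Step : Set where
  r f : Step

-- Reflection in a vertical line turns a rise into a fall and vice versa.
flipStep : Step → Step
flipStep r = f
flipStep f = r

stepValue : Step → ℤ
stepValue r = ℤ.+ 1
stepValue f = ℤ.-[1+ 0 ]

height : List Step → ℤ
height [] = ℤ.+ 0
height (s ∷ p) = stepValue s ℤ.+ height p

-- y-coordinate of the lattice point of p with x-coordinate i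
heightAt : List Step → ℕ → ℤ
heightAt p i = height (take i p)

IsDyck : ℕ → List Step → Set
IsDyck n p = (length p ≡ 4 * n) × (∀ i → ℤ.+ 0 ℤ.≤ heightAt p i) × (height p ≡ ℤ.+ 0)

-- symmetric about the line x = 2n (the midpoint of the path)
IsSymmetric : List Step → Set
IsSymmetric p = reverse (map flipStep p) ≡ p

InJ : ℕ → List Step → Set
InJ n p = IsDyck n p × IsSymmetric p

_≼_ : List Step → List Step → Set
μ ≼ ν = ∀ i → heightAt μ i ℤ.≤ heightAt ν i

_≺_ : List Step → List Step → Set
μ ≺ ν = μ ≼ ν × μ ≢ ν

Covers : ℕ → List Step → List Step → Set
Covers n x y = InJ n y × x ≺ y × ¬ (Σ (List Step) λ z → InJ n z × x ≺ z × z ≺ y)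

IsJoin : ℕ → (List Step → Set) → List Step → Set
IsJoin n S m = InJ n m × (∀ y → S y → y ≼ m)
             × (∀ z → InJ n z → (∀ y → S y → y ≼ z) → m ≼ z)

IsPopUpOf : ℕ → List Step → List Step → Set
IsPopUpOf n x m = IsJoin n (λ y → y ≡ x ⊎ Covers n x y) m

InPopImage : ℕ → List Step → Set
InPopImage n μ = Σ (List Step) λ x → InJ n x × IsPopUpOf n x μ

NoFFRR : List Step → Set
NoFFRR μ = ¬ (Σ (List Step) λ xs → Σ (List Step) λ ys → μ ≡ xs ++ (f ∷ f ∷ r ∷ r ∷ ys))

OnlyEndpointsOnAxis : ℕ → List Step → Set
OnlyEndpointsOnAxis n μ = ∀ i → 0 < i → i < 4 * n → heightAt μ i ≢ ℤ.+ 0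

{-# OPTIONS --safe #-}
-- A path covering x in J(Φ⁺_{B_n}) is obtained by turning a valley f r of x at some
-- lattice point v, together with its mirror image at 4n − v, into a peak r f; conversely, any
-- path strictly above x lies weakly above one of these (follow it from its first divergence
-- from x along the falls of x down to a valley). Hence Pop↑(x) raises every valley of x by 2.
-- The result has no f f r r, and it meets the axis only at its ends because an interior zero
-- of x is a valley. Conversely, a path μ with these two properties is Pop↑ of the path
-- obtained by lowering all peaks of μ, which stays weakly above the axis because every peak
-- of μ has height at least 2.
module Submission where

open import Defs
open import Data.Bool using (Bool; true; false; _∧_; _∨_; if_then_else_)
open import Data.Bool.Properties using (∧-zeroʳ; ∧-identityʳ; ∧-comm; ∨-comm; T-≡)
open import Data.Empty using (⊥-elim)
open import Data.Integer as ℤ using (ℤ; +_; -[1+_]; _+_; -_; _≤_)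
import Data.Integer.Properties as ℤP
open import Data.Integer.Tactic.RingSolver using (solve-∀)
open import Algebra.Properties.AbelianGroup ℤP.+-0-abelianGroup
  using () renaming (∙-cancelˡ to +-cancelˡ-≡; ∙-cancelʳ to +-cancelʳ-≡)
open import Data.List using (List; []; _∷_; _++_; length; reverse; map; [_])
import Data.List.Properties as ListP
open import Data.Nat as ℕ using (ℕ; zero; suc; _∸_; z≤n; s≤s)
import Data.Nat.Properties as ℕP
open import Data.Product using (Σ; _×_; _,_; proj₁; proj₂)
open import Data.Sum using (_⊎_; inj₁; inj₂)
open import Function.Base using (_∘_)
open import Function.Bundles using (_⇔_; mk⇔; Equivalence)
open import Relation.Nullary using (¬_; Dec; yes; no; does)
open import Relation.Nullary.Decidable using (dec-true; dec-false)
open import Relation.Binary.PropositionalEquality hiding ([_])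

-[i]+[i+j]≡j : ∀ i j → - i + (i + j) ≡ j
-[i]+[i+j]≡j = solve-∀

+-cancelˡ-≤ : ∀ i {j k} → i + j ≤ i + k → j ≤ k
+-cancelˡ-≤ i {j} {k} le = subst₂ _≤_ (-[i]+[i+j]≡j i j) (-[i]+[i+j]≡j i k) (ℤP.+-monoʳ-≤ (- i) le)

1+[-1+i]≡i : ∀ i → + 1 + (-[1+ 0 ] + i) ≡ i
1+[-1+i]≡i = solve-∀

-1+[1+i]≡i : ∀ i → -[1+ 0 ] + (+ 1 + i) ≡ i
-1+[1+i]≡i = solve-∀

i+2≰i : ∀ i → ¬ (i + + 2 ≤ i)
i+2≰i i le with +-cancelˡ-≤ i (subst (i + + 2 ≤_) (sym (ℤP.+-identityʳ i)) le)
... | ℤ.+≤+ ()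

i+1+n≢0 : ∀ {i} n → + 0 ≤ i → i + + suc n ≢ + 0
i+1+n≢0 {+ m} n _ eq = ℕP.m+1+n≢0 m (cong ℤ.∣_∣ eq)

_≟ₛ_ : (a b : Step) → Dec (a ≡ b)
r ≟ₛ r = yes refl
f ≟ₛ f = yes refl
r ≟ₛ f = no λ ()
f ≟ₛ r = no λ ()

-- Past the end of the path, stepAt returns the junk value r.
stepAt : List Step → ℕ → Step
stepAt []      _       = r
stepAt (s ∷ p) zero    = s
stepAt (s ∷ p) (suc i) = stepAt p i

heightAt-suc : ∀ p i → i ℕ.< length p → heightAt p (suc i) ≡ heightAt p i + stepValue (stepAt p i)
heightAt-suc (s ∷ p) zero    _         = ℤP.+-comm (stepValue s) (+ 0)
heightAt-suc (s ∷ p) (suc i) (s≤s i<p) =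
  trans (cong (_+_ (stepValue s)) (heightAt-suc p i i<p)) (sym (ℤP.+-assoc (stepValue s) _ _))

heightAt-suc-step : ∀ p {i s} → i ℕ.< length p → stepAt p i ≡ s → heightAt p (suc i) ≡ heightAt p i + stepValue s
heightAt-suc-step p {i} i<p refl = heightAt-suc p i i<p

heightAt-beyond : ∀ p i → length p ℕ.≤ i → heightAt p i ≡ height p
heightAt-beyond p i le = cong height (ListP.take-all i p le)

heightAt-++ˡ : ∀ p q i → i ℕ.≤ length p → heightAt (p ++ q) i ≡ heightAt p i
heightAt-++ˡ p       q zero    _          = refl
heightAt-++ˡ (s ∷ p) q (suc i) (s≤s i≤p) = cong (_+_ (stepValue s)) (heightAt-++ˡ p q i i≤p)

heightAt-∷flip∷ : ∀ s p i → heightAt (s ∷ flipStep s ∷ p) (suc (suc i)) ≡ heightAt p i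
heightAt-∷flip∷ r p i = 1+[-1+i]≡i (heightAt p i)
heightAt-∷flip∷ f p i = -1+[1+i]≡i (heightAt p i)

height-++ : ∀ p q → height (p ++ q) ≡ height p + height q
height-++ []      q = sym (ℤP.+-identityˡ _)
height-++ (s ∷ p) q = trans (cong (_+_ (stepValue s)) (height-++ p q)) (sym (ℤP.+-assoc (stepValue s) _ _))

height-reverse : ∀ p → height (reverse p) ≡ height p
height-reverse []      = refl
height-reverse (s ∷ p) = begin
  height (reverse (s ∷ p))              ≡⟨ cong height (ListP.unfold-reverse s p) ⟩
  height (reverse p ++ [ s ])           ≡⟨ height-++ (reverse p) [ s ] ⟩
  height (reverse p) + (stepValue s + + 0) ≡⟨ cong₂ _+_ (height-reverse p) (ℤP.+-identityʳ _) ⟩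
  height p + stepValue s                ≡⟨ ℤP.+-comm (height p) _ ⟩
  height (s ∷ p)                        ∎
  where open ≡-Reasoning

stepValue-flipStep : ∀ s → stepValue (flipStep s) ≡ - stepValue s
stepValue-flipStep r = refl
stepValue-flipStep f = refl

height-map-flipStep : ∀ p → height (map flipStep p) ≡ - height p
height-map-flipStep []      = refl
height-map-flipStep (s ∷ p) =
  trans (cong₂ _+_ (stepValue-flipStep s) (height-map-flipStep p)) (sym (ℤP.neg-distrib-+ (stepValue s) (height p)))

stepValue-injective : ∀ s t → stepValue s ≡ stepValue t → s ≡ t
stepValue-injective r r _ = refl
stepValue-injective f f _ = refl

≡-from-heightAt : ∀ p q → length p ≡ length q → (∀ i → i ℕ.≤ length p → heightAt p i ≡ heightAt q i) → p ≡ q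
≡-from-heightAt []      []      _   _    = refl
≡-from-heightAt (s ∷ p) (t ∷ q) len same
  with refl ← stepValue-injective s t (+-cancelʳ-≡ (+ 0) _ _ (same 1 (s≤s z≤n))) =
  cong (s ∷_) (≡-from-heightAt p q (ℕP.suc-injective len)
    λ i i≤p → +-cancelˡ-≡ (stepValue s) _ _ (same (suc i) (s≤s i≤p)))

length-reverse-flip : ∀ p → length (reverse (map flipStep p)) ≡ length p
length-reverse-flip p = trans (ListP.length-reverse (map flipStep p)) (ListP.length-map flipStep p)

heightAt-reverse-flip : ∀ p i k → i ℕ.+ k ≡ length p →
  heightAt (reverse (map flipStep p)) i + height p ≡ heightAt p k
heightAt-reverse-flip []      zero zero _ = refl
heightAt-reverse-flip (s ∷ p) i zero i+0≡ = begin
  heightAt p̄ i + height (s ∷ p)       ≡⟨ cong (_+ height (s ∷ p)) (heightAt-beyond p̄ i p̄≤i) ⟩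
  height p̄ + height (s ∷ p)
    ≡⟨ cong (_+ height (s ∷ p)) (trans (height-reverse (map flipStep (s ∷ p))) (height-map-flipStep (s ∷ p))) ⟩
  - height (s ∷ p) + height (s ∷ p)   ≡⟨ ℤP.+-inverseˡ (height (s ∷ p)) ⟩
  + 0                                 ∎
  where
    open ≡-Reasoning
    p̄ = reverse (map flipStep (s ∷ p))
    p̄≤i : length p̄ ℕ.≤ i
    p̄≤i = ℕP.≤-reflexive (trans (length-reverse-flip (s ∷ p)) (trans (sym i+0≡) (ℕP.+-identityʳ i)))
heightAt-reverse-flip (s ∷ p) i (suc k) i+k≡ = begin
  heightAt (reverse (map flipStep (s ∷ p))) i + height (s ∷ p)
    ≡⟨ cong (λ q → heightAt q i + height (s ∷ p)) (ListP.unfold-reverse (flipStep s) (map flipStep p)) ⟩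
  heightAt (p̄ ++ [ flipStep s ]) i + (stepValue s + height p)
    ≡⟨ cong (_+ (stepValue s + height p)) (heightAt-++ˡ p̄ _ i i≤p̄) ⟩
  heightAt p̄ i + (stepValue s + height p)
    ≡⟨ x+[y+z]≡y+[x+z] (heightAt p̄ i) (stepValue s) (height p) ⟩
  stepValue s + (heightAt p̄ i + height p)
    ≡⟨ cong (_+_ (stepValue s)) (heightAt-reverse-flip p i k i+k≡p) ⟩
  stepValue s + heightAt p k ∎
  where
    open ≡-Reasoning
    p̄ = reverse (map flipStep p)
    x+[y+z]≡y+[x+z] : ∀ x y z → x + (y + z) ≡ y + (x + z)
    x+[y+z]≡y+[x+z] = solve-∀
    i+k≡p : i ℕ.+ k ≡ length p
    i+k≡p = ℕP.suc-injective (trans (sym (ℕP.+-suc i k)) i+k≡)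
    i≤p̄ : i ℕ.≤ length p̄
    i≤p̄ = subst (i ℕ.≤_) (sym (length-reverse-flip p)) (subst (i ℕ.≤_) i+k≡p (ℕP.m≤m+n i k))

Mirrored : ℕ → List Step → Set
Mirrored N p = ∀ i k → i ℕ.+ k ≡ N → heightAt p i ≡ heightAt p k

symmetric⇒mirrored : ∀ p → height p ≡ + 0 → IsSymmetric p → Mirrored (length p) p
symmetric⇒mirrored p h≡0 p-sym i k i+k≡ = begin
  heightAt p i                                       ≡⟨ sym (ℤP.+-identityʳ _) ⟩
  heightAt p i + + 0                                 ≡⟨ cong₂ (λ q h → heightAt q i + h) (sym p-sym) (sym h≡0) ⟩
  heightAt (reverse (map flipStep p)) i + height p   ≡⟨ heightAt-reverse-flip p i k i+k≡ ⟩
  heightAt p k                                       ∎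
  where open ≡-Reasoning

mirrored⇒symmetric : ∀ p → height p ≡ + 0 → Mirrored (length p) p → IsSymmetric p
mirrored⇒symmetric p h≡0 p-mir = ≡-from-heightAt _ p (length-reverse-flip p) λ i i≤ →
  let i≤p = subst (i ℕ.≤_) (length-reverse-flip p) i≤
      i+k≡ = ℕP.m+[n∸m]≡n i≤p
  in begin
    heightAt p̄ i                       ≡⟨ sym (ℤP.+-identityʳ _) ⟩
    heightAt p̄ i + + 0                 ≡⟨ cong (_+_ (heightAt p̄ i)) (sym h≡0) ⟩
    heightAt p̄ i + height p            ≡⟨ heightAt-reverse-flip p i (length p ∸ i) i+k≡ ⟩
    heightAt p (length p ∸ i)          ≡⟨ sym (p-mir i (length p ∸ i) i+k≡) ⟩
    heightAt p i                       ∎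
  where
    open ≡-Reasoning
    p̄ = reverse (map flipStep p)

record SymmetricDyck (N : ℕ) (p : List Step) : Set where
  field
    length≡N : length p ≡ N
    nonneg   : ∀ i → + 0 ≤ heightAt p i
    height≡0 : height p ≡ + 0
    mirrored : Mirrored N p
open SymmetricDyck

InJ⇒SymmetricDyck : ∀ {n p} → InJ n p → SymmetricDyck (4 ℕ.* n) p
InJ⇒SymmetricDyck {p = p} ((len , nonneg , h≡0) , p-sym) = record
  { length≡N = len ; nonneg = nonneg ; height≡0 = h≡0
  ; mirrored = subst (λ N → Mirrored N p) len (symmetric⇒mirrored p h≡0 p-sym) }

SymmetricDyck⇒InJ : ∀ {n p} → SymmetricDyck (4 ℕ.* n) p → InJ n p
SymmetricDyck⇒InJ {p = p} d = (length≡N d , nonneg d , height≡0 d)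
  , mirrored⇒symmetric p (height≡0 d) (subst (λ N → Mirrored N p) (sym (length≡N d)) (mirrored d))

<-of-+suc : ∀ j k {N} → j ℕ.+ suc k ≡ N → j ℕ.< N
<-of-+suc j k eq = subst (j ℕ.<_) eq (ℕP.m<m+n j ℕ.z<s)

flipStep-of-opposite : ∀ a b → stepValue a + stepValue b ≡ + 0 → b ≡ flipStep a
flipStep-of-opposite r f _ = refl
flipStep-of-opposite f r _ = refl

stepAt-mirror : ∀ {N p} → length p ≡ N → Mirrored N p → ∀ j k → j ℕ.+ suc k ≡ N →
                stepAt p j ≡ flipStep (stepAt p k)
stepAt-mirror {N} {p} len p-mir j k j+1+k≡ =
  flipStep-of-opposite (stepAt p k) (stepAt p j) (+-cancelˡ-≡ (heightAt p k) _ _ (begin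
    heightAt p k + (sₖ + sⱼ)   ≡⟨ sym (ℤP.+-assoc (heightAt p k) sₖ sⱼ) ⟩
    heightAt p k + sₖ + sⱼ     ≡⟨ cong (_+ sⱼ) (sym (heightAt-suc p k k<p)) ⟩
    heightAt p (suc k) + sⱼ    ≡⟨ cong (_+ sⱼ) (sym (p-mir j (suc k) j+1+k≡)) ⟩
    heightAt p j + sⱼ          ≡⟨ sym (heightAt-suc p j j<p) ⟩
    heightAt p (suc j)         ≡⟨ p-mir (suc j) k (trans (sym (ℕP.+-suc j k)) j+1+k≡) ⟩
    heightAt p k               ≡⟨ sym (ℤP.+-identityʳ _) ⟩
    heightAt p k + + 0         ∎))
  where
    open ≡-Reasoning
    sⱼ = stepValue (stepAt p j)
    sₖ = stepValue (stepAt p k)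
    j<p : j ℕ.< length p
    j<p = subst (j ℕ.<_) (sym len) (<-of-+suc j k j+1+k≡)
    k<p : k ℕ.< length p
    k<p = subst (k ℕ.<_) (sym len)
                (<-of-+suc k j (trans (ℕP.+-comm k (suc j)) (trans (sym (ℕP.+-suc j k)) j+1+k≡)))

-- corner a b p i: lattice point i of p is entered by the step a and left by the step b.
corner : Step → Step → List Step → ℕ → Bool
corner a b p zero    = false
corner a b p (suc j) = does (stepAt p j ≟ₛ a) ∧ does (stepAt p (suc j) ≟ₛ b) ∧ does (suc j ℕ.<? length p)

valley peak : List Step → ℕ → Bool
valley = corner f r
peak   = corner r f

CornerAt : Step → Step → List Step → ℕ → Set
CornerAt a b p j = stepAt p j ≡ a × stepAt p (suc j) ≡ b × suc j ℕ.< length p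

corner-sound : ∀ a b p i → corner a b p i ≡ true → Σ ℕ λ j → i ≡ suc j × CornerAt a b p j
corner-sound a b p (suc j) eq with suc j ℕ.<? length p | stepAt p j ≟ₛ a | stepAt p (suc j) ≟ₛ b
corner-sound a b p (suc j) eq  | yes lt | yes e₁ | yes e₂ = j , refl , e₁ , e₂ , lt
corner-sound a b p (suc j) eq  | no ¬lt | yes _  | yes _ =
  ⊥-elim (¬lt (ℕP.<ᵇ⇒< (suc j) (length p) (Equivalence.from T-≡ eq)))
corner-sound a b p (suc j) ()  | _      | yes _  | no _
corner-sound a b p (suc j) ()  | _      | no _   | _

corner-complete : ∀ a b p j → CornerAt a b p j → corner a b p (suc j) ≡ true
corner-complete a b p j (e₁ , e₂ , lt)
  rewrite dec-true (stepAt p j ≟ₛ a) e₁ | dec-true (stepAt p (suc j) ≟ₛ b) e₂ | dec-true (suc j ℕ.<? length p) lt = refl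

corner-beyond : ∀ a b p i → length p ℕ.≤ i → corner a b p i ≡ false
corner-beyond a b p zero    _  = refl
corner-beyond a b p (suc j) le rewrite dec-false (suc j ℕ.<? length p) (ℕP.≤⇒≯ le) =
  trans (cong (does (stepAt p j ≟ₛ a) ∧_) (∧-zeroʳ _)) (∧-zeroʳ _)

corner-∷ : ∀ {a b s} p j → s ≢ a → corner a b (s ∷ p) (suc j) ≡ corner a b p j
corner-∷ {a} {s = s} p zero    s≢a rewrite dec-false (s ≟ₛ a) s≢a = refl
corner-∷             p (suc j) _   = refl

corner-∷∷ : ∀ {a b s t} p j → t ≢ b → corner a b (s ∷ t ∷ p) (suc j) ≡ corner a b (t ∷ p) j
corner-∷∷ {a} {b} {s} {t} p zero t≢b rewrite dec-false (t ≟ₛ b) t≢b = ∧-zeroʳ (does (s ≟ₛ a))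
corner-∷∷                 p (suc j) _ = refl

does-flipStep-≟ : ∀ x y → does (flipStep x ≟ₛ y) ≡ does (x ≟ₛ flipStep y)
does-flipStep-≟ r r = refl
does-flipStep-≟ r f = refl
does-flipStep-≟ f r = refl
does-flipStep-≟ f f = refl

corner-mirror : ∀ {N p} a b → length p ≡ N → Mirrored N p → ∀ i k → i ℕ.+ k ≡ N →
                corner a b p k ≡ corner (flipStep b) (flipStep a) p i
corner-mirror a b len p-mir zero    zero    _     = refl
corner-mirror {p = p} a b len p-mir (suc i) zero    i+0≡N =
  sym (corner-beyond _ _ p (suc i) (ℕP.≤-reflexive (trans len (trans (sym i+0≡N) (ℕP.+-identityʳ _)))))
corner-mirror {p = p} a b len p-mir zero    (suc k) k≡N = corner-beyond _ _ p (suc k) (ℕP.≤-reflexive (trans len (sym k≡N)))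
corner-mirror {N} {p} a b len p-mir (suc i) (suc k) i+k≡N
  rewrite stepAt-mirror len p-mir k (suc i) (trans (ℕP.+-suc k (suc i)) (trans (ℕP.+-comm (suc k) (suc i)) i+k≡N))
        | stepAt-mirror len p-mir (suc k) i (trans (ℕP.+-comm (suc k) (suc i)) i+k≡N)
        | dec-true (suc k ℕ.<? length p)
                   (subst (suc k ℕ.<_) (sym len) (<-of-+suc (suc k) i (trans (ℕP.+-comm (suc k) (suc i)) i+k≡N)))
        | dec-true (suc i ℕ.<? length p) (subst (suc i ℕ.<_) (sym len) (<-of-+suc (suc i) k i+k≡N))
        | does-flipStep-≟ (stepAt p (suc i)) a
        | does-flipStep-≟ (stepAt p i) b
        | ∧-identityʳ (does (stepAt p i ≟ₛ flipStep b))
        | ∧-identityʳ (does (stepAt p (suc i) ≟ₛ flipStep a))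
  = ∧-comm (does (stepAt p (suc i) ≟ₛ flipStep a)) (does (stepAt p i ≟ₛ flipStep b))

bump : Bool → ℤ
bump true  = + 2
bump false = + 0

i≤i+bump : ∀ i b → i ≤ i + bump b
i≤i+bump i true  = ℤP.i≤i+j i (+ 2)
i≤i+bump i false = ℤP.i≤i+j i (+ 0)

raiseValleys : (ℕ → Bool) → List Step → List Step
raiseValleys P []          = []
raiseValleys P (r ∷ p)     = r ∷ raiseValleys (P ∘ suc) p
raiseValleys P (f ∷ [])    = f ∷ []
raiseValleys P (f ∷ f ∷ p) = f ∷ raiseValleys (P ∘ suc) (f ∷ p)
raiseValleys P (f ∷ r ∷ p) =
  if P 1 then r ∷ f ∷ raiseValleys (P ∘ suc ∘ suc) p else f ∷ r ∷ raiseValleys (P ∘ suc ∘ suc) p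

length-raiseValleys : ∀ P p → length (raiseValleys P p) ≡ length p
length-raiseValleys P []          = refl
length-raiseValleys P (r ∷ p)     = cong suc (length-raiseValleys (P ∘ suc) p)
length-raiseValleys P (f ∷ [])    = refl
length-raiseValleys P (f ∷ f ∷ p) = cong suc (length-raiseValleys (P ∘ suc) (f ∷ p))
length-raiseValleys P (f ∷ r ∷ p) with P 1
... | true  = cong (suc ∘ suc) (length-raiseValleys (P ∘ suc ∘ suc) p)
... | false = cong (suc ∘ suc) (length-raiseValleys (P ∘ suc ∘ suc) p)

heightAt-if-swap : ∀ b p i → heightAt (if b then r ∷ f ∷ p else f ∷ r ∷ p) (suc (suc i)) ≡ heightAt p i
heightAt-if-swap true  = heightAt-∷flip∷ r
heightAt-if-swap false = heightAt-∷flip∷ f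

prefix-step : ∀ s h′ {h b b′} → h ≡ h′ + bump b → b ≡ b′ → s + h ≡ s + h′ + bump b′
prefix-step s h′ refl refl = sym (ℤP.+-assoc s _ _)

heightAt-raiseValleys : ∀ P p i → heightAt (raiseValleys P p) i ≡ heightAt p i + bump (valley p i ∧ P i)
heightAt-raiseValleys P []          zero    = refl
heightAt-raiseValleys P []          (suc i) = refl
heightAt-raiseValleys P (r ∷ p)     zero    = refl
heightAt-raiseValleys P (r ∷ p)     (suc i) =
  prefix-step (+ 1) (heightAt p i) (heightAt-raiseValleys (P ∘ suc) p i)
              (cong (_∧ P (suc i)) (sym (corner-∷ {f} {r} {r} p i λ ())))
heightAt-raiseValleys P (f ∷ [])    zero    = refl
heightAt-raiseValleys P (f ∷ [])    (suc i) = sym (trans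
  (cong (λ b → heightAt (f ∷ []) (suc i) + bump (b ∧ P (suc i))) (corner-beyond f r (f ∷ []) (suc i) (s≤s z≤n)))
  (ℤP.+-identityʳ _))
heightAt-raiseValleys P (f ∷ f ∷ p) zero    = refl
heightAt-raiseValleys P (f ∷ f ∷ p) (suc i) =
  prefix-step -[1+ 0 ] (heightAt (f ∷ p) i) (heightAt-raiseValleys (P ∘ suc) (f ∷ p) i)
              (cong (_∧ P (suc i)) (sym (corner-∷∷ {f} {r} {f} {f} p i λ ())))
heightAt-raiseValleys P (f ∷ r ∷ p) zero    = refl
heightAt-raiseValleys P (f ∷ r ∷ p) (suc zero) with P 1
... | true  = refl
... | false = refl
heightAt-raiseValleys P (f ∷ r ∷ p) (suc (suc i)) = begin
  heightAt (if P 1 then r ∷ f ∷ p′ else f ∷ r ∷ p′) (suc (suc i))  ≡⟨ heightAt-if-swap (P 1) p′ i ⟩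
  heightAt p′ i                                                    ≡⟨ heightAt-raiseValleys (P ∘ suc ∘ suc) p i ⟩
  heightAt p i + bump (valley p i ∧ P (suc (suc i)))
    ≡⟨ cong₂ (λ h b → h + bump (b ∧ P (suc (suc i)))) (sym (heightAt-∷flip∷ f p i)) (sym (corner-∷ {f} {r} {r} p i λ ())) ⟩
  heightAt (f ∷ r ∷ p) (suc (suc i)) + bump (valley (f ∷ r ∷ p) (suc (suc i)) ∧ P (suc (suc i))) ∎
  where
    open ≡-Reasoning
    p′ = raiseValleys (P ∘ suc ∘ suc) p

heightAt-raiseValleys-bump : ∀ P p i {b} → valley p i ∧ P i ≡ b → heightAt (raiseValleys P p) i ≡ heightAt p i + bump b
heightAt-raiseValleys-bump P p i refl = heightAt-raiseValleys P p i

valley-mirror : ∀ {N p} → length p ≡ N → Mirrored N p → ∀ i k → i ℕ.+ k ≡ N → valley p i ≡ valley p k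
valley-mirror len p-mir i k i+k≡N = sym (corner-mirror f r len p-mir i k i+k≡N)

peak-mirror : ∀ {N p} → length p ≡ N → Mirrored N p → ∀ i k → i ℕ.+ k ≡ N → peak p i ≡ peak p k
peak-mirror len p-mir i k i+k≡N = sym (corner-mirror r f len p-mir i k i+k≡N)

raiseValleys-symmetricDyck : ∀ {N p} P → (∀ i k → i ℕ.+ k ≡ N → P i ≡ P k) →
                             SymmetricDyck N p → SymmetricDyck N (raiseValleys P p)
raiseValleys-symmetricDyck {N} {p} P P-mir d = record
  { length≡N = trans (length-raiseValleys P p) (length≡N d)
  ; nonneg   = λ i → ℤP.≤-trans (nonneg d i) (subst (heightAt p i ≤_) (sym (heightAt-raiseValleys P p i)) (i≤i+bump _ _))
  ; height≡0 = begin
      height (raiseValleys P p)               ≡⟨ sym (heightAt-beyond _ N (ℕP.≤-reflexive (trans (length-raiseValleys P p) (length≡N d)))) ⟩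
      heightAt (raiseValleys P p) N           ≡⟨ heightAt-raiseValleys P p N ⟩
      heightAt p N + bump (valley p N ∧ P N)  ≡⟨ cong (λ b → heightAt p N + bump (b ∧ P N)) (corner-beyond f r p N N≥p) ⟩
      heightAt p N + + 0                      ≡⟨ ℤP.+-identityʳ _ ⟩
      heightAt p N                            ≡⟨ heightAt-beyond p N N≥p ⟩
      height p                                ≡⟨ height≡0 d ⟩
      + 0                                     ∎
  ; mirrored = λ i k i+k≡N → begin
      heightAt (raiseValleys P p) i               ≡⟨ heightAt-raiseValleys P p i ⟩
      heightAt p i + bump (valley p i ∧ P i)
        ≡⟨ cong₂ (λ h b → h + bump b) (mirrored d i k i+k≡N)
                 (cong₂ _∧_ (valley-mirror (length≡N d) (mirrored d) i k i+k≡N) (P-mir i k i+k≡N)) ⟩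
      heightAt p k + bump (valley p k ∧ P k)      ≡⟨ sym (heightAt-raiseValleys P p k) ⟩
      heightAt (raiseValleys P p) k               ∎
  }
  where
    open ≡-Reasoning
    N≥p = ℕP.≤-reflexive (length≡N d)

lowerPeaks : List Step → List Step
lowerPeaks []          = []
lowerPeaks (f ∷ p)     = f ∷ lowerPeaks p
lowerPeaks (r ∷ [])    = r ∷ []
lowerPeaks (r ∷ f ∷ p) = f ∷ r ∷ lowerPeaks p
lowerPeaks (r ∷ r ∷ p) = r ∷ lowerPeaks (r ∷ p)

length-lowerPeaks : ∀ p → length (lowerPeaks p) ≡ length p
length-lowerPeaks []          = refl
length-lowerPeaks (f ∷ p)     = cong suc (length-lowerPeaks p)
length-lowerPeaks (r ∷ [])    = refl
length-lowerPeaks (r ∷ f ∷ p) = cong (suc ∘ suc) (length-lowerPeaks p)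
length-lowerPeaks (r ∷ r ∷ p) = cong suc (length-lowerPeaks (r ∷ p))

heightAt-lowerPeaks : ∀ p i → heightAt (lowerPeaks p) i + bump (peak p i) ≡ heightAt p i
heightAt-lowerPeaks []          zero          = refl
heightAt-lowerPeaks []          (suc i)       = refl
heightAt-lowerPeaks (f ∷ p)     zero          = refl
heightAt-lowerPeaks (f ∷ p)     (suc i)       =
  sym (prefix-step -[1+ 0 ] (heightAt (lowerPeaks p) i) (sym (heightAt-lowerPeaks p i)) (sym (corner-∷ {r} {f} {f} p i λ ())))
heightAt-lowerPeaks (r ∷ [])    zero          = refl
heightAt-lowerPeaks (r ∷ [])    (suc zero)    = refl
heightAt-lowerPeaks (r ∷ [])    (suc (suc i)) = refl
heightAt-lowerPeaks (r ∷ f ∷ p) zero          = refl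
heightAt-lowerPeaks (r ∷ f ∷ p) (suc zero)    = refl
heightAt-lowerPeaks (r ∷ f ∷ p) (suc (suc i)) = begin
  heightAt (f ∷ r ∷ lowerPeaks p) (suc (suc i)) + bump (peak (r ∷ f ∷ p) (suc (suc i)))
    ≡⟨ cong₂ (λ h b → h + bump b) (heightAt-∷flip∷ f (lowerPeaks p) i) (corner-∷ {r} {f} {f} p i λ ()) ⟩
  heightAt (lowerPeaks p) i + bump (peak p i) ≡⟨ heightAt-lowerPeaks p i ⟩
  heightAt p i                                ≡⟨ sym (heightAt-∷flip∷ r p i) ⟩
  heightAt (r ∷ f ∷ p) (suc (suc i))          ∎
  where open ≡-Reasoning
heightAt-lowerPeaks (r ∷ r ∷ p) zero          = refl
heightAt-lowerPeaks (r ∷ r ∷ p) (suc i)       =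
  sym (prefix-step (+ 1) (heightAt (lowerPeaks (r ∷ p)) i) (sym (heightAt-lowerPeaks (r ∷ p) i))
                   (sym (corner-∷∷ {r} {f} {r} {r} p i λ ())))

heightAt-lowerPeaks-bump : ∀ p i {b} → peak p i ≡ b → heightAt (lowerPeaks p) i + bump b ≡ heightAt p i
heightAt-lowerPeaks-bump p i refl = heightAt-lowerPeaks p i

raiseAllValleys : List Step → List Step
raiseAllValleys = raiseValleys (λ _ → true)

heightAt-raiseAllValleys : ∀ p i {b} → valley p i ≡ b → heightAt (raiseAllValleys p) i ≡ heightAt p i + bump b
heightAt-raiseAllValleys p i {b} v≡b = heightAt-raiseValleys-bump _ p i (trans (cong (_∧ true) v≡b) (∧-identityʳ b))

NoFinalRise : List Step → Set
NoFinalRise p = ¬ (Σ (List Step) λ xs → p ≡ xs ++ r ∷ [])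

NoFFRR-tail : ∀ {s p} → NoFFRR (s ∷ p) → NoFFRR p
NoFFRR-tail no-ffrr (xs , ys , eq) = no-ffrr (_ ∷ xs , ys , cong (_ ∷_) eq)

NoFFRR-∷r : ∀ {s p} → NoFFRR (r ∷ p) → NoFFRR (s ∷ r ∷ p)
NoFFRR-∷r no-ffrr (_ ∷ xs , ys , eq) = no-ffrr (xs , ys , ListP.∷-injectiveʳ eq)

NoFinalRise-tail : ∀ {s p} → NoFinalRise (s ∷ p) → NoFinalRise p
NoFinalRise-tail no-r (xs , eq) = no-r (_ ∷ xs , cong (_ ∷_) eq)

-- The extra f in front of μ also excludes a leading f r r, which lowerPeaks leaves alone
-- but raising would change.
raiseAllValleys-lowerPeaks : ∀ μ → NoFFRR (f ∷ μ) → NoFinalRise μ → raiseAllValleys (lowerPeaks μ) ≡ μ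
raiseAllValleys-lowerPeaks []              _       _    = refl
raiseAllValleys-lowerPeaks (f ∷ [])        _       _    = refl
raiseAllValleys-lowerPeaks (f ∷ f ∷ p)     no-ffrr no-r =
  cong (f ∷_) (raiseAllValleys-lowerPeaks (f ∷ p) (NoFFRR-tail no-ffrr) (NoFinalRise-tail no-r))
raiseAllValleys-lowerPeaks (f ∷ r ∷ [])    _       no-r = ⊥-elim (no-r (f ∷ [] , refl))
raiseAllValleys-lowerPeaks (f ∷ r ∷ r ∷ p) no-ffrr _    = ⊥-elim (no-ffrr ([] , p , refl))
raiseAllValleys-lowerPeaks (f ∷ r ∷ f ∷ p) no-ffrr no-r =
  cong (f ∷_) (raiseAllValleys-lowerPeaks (r ∷ f ∷ p) (NoFFRR-tail no-ffrr) (NoFinalRise-tail no-r))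
raiseAllValleys-lowerPeaks (r ∷ [])        _       _    = refl
raiseAllValleys-lowerPeaks (r ∷ f ∷ p)     no-ffrr no-r =
  cong ((r ∷_) ∘ (f ∷_)) (raiseAllValleys-lowerPeaks p (NoFFRR-tail (NoFFRR-tail no-ffrr)) (NoFinalRise-tail (NoFinalRise-tail no-r)))
raiseAllValleys-lowerPeaks (r ∷ r ∷ p)     no-ffrr no-r =
  cong (r ∷_) (raiseAllValleys-lowerPeaks (r ∷ p) (NoFFRR-∷r (NoFFRR-tail (NoFFRR-tail no-ffrr))) (NoFinalRise-tail no-r))

raiseAllValleys-f∷≢rr∷ : ∀ p ys → raiseAllValleys (f ∷ p) ≢ r ∷ r ∷ ys
raiseAllValleys-f∷≢rr∷ []      ys ()
raiseAllValleys-f∷≢rr∷ (r ∷ p) ys ()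
raiseAllValleys-f∷≢rr∷ (f ∷ p) ys ()

raiseAllValleys-≢frr∷ : ∀ p ys → raiseAllValleys p ≢ f ∷ r ∷ r ∷ ys
raiseAllValleys-≢frr∷ []          ys ()
raiseAllValleys-≢frr∷ (r ∷ p)     ys ()
raiseAllValleys-≢frr∷ (f ∷ [])    ys ()
raiseAllValleys-≢frr∷ (f ∷ r ∷ p) ys ()
raiseAllValleys-≢frr∷ (f ∷ f ∷ p) ys eq = raiseAllValleys-f∷≢rr∷ p ys (ListP.∷-injectiveʳ eq)

raiseAllValleys-NoFFRR : ∀ p → NoFFRR (raiseAllValleys p)
raiseAllValleys-NoFFRR []          ([] , _ , ())
raiseAllValleys-NoFFRR []          (_ ∷ _ , _ , ())
raiseAllValleys-NoFFRR (r ∷ p)     ([] , _ , ())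
raiseAllValleys-NoFFRR (r ∷ p)     (_ ∷ xs , ys , eq) = raiseAllValleys-NoFFRR p (xs , ys , ListP.∷-injectiveʳ eq)
raiseAllValleys-NoFFRR (f ∷ [])    ([] , _ , ())
raiseAllValleys-NoFFRR (f ∷ [])    (_ ∷ [] , _ , ())
raiseAllValleys-NoFFRR (f ∷ [])    (_ ∷ _ ∷ _ , _ , ())
raiseAllValleys-NoFFRR (f ∷ f ∷ p) ([] , ys , eq)     = raiseAllValleys-≢frr∷ (f ∷ p) ys (ListP.∷-injectiveʳ eq)
raiseAllValleys-NoFFRR (f ∷ f ∷ p) (_ ∷ xs , ys , eq) = raiseAllValleys-NoFFRR (f ∷ p) (xs , ys , ListP.∷-injectiveʳ eq)
raiseAllValleys-NoFFRR (f ∷ r ∷ p) ([] , _ , ())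
raiseAllValleys-NoFFRR (f ∷ r ∷ p) (_ ∷ [] , ys , eq) =
  raiseAllValleys-≢frr∷ p ys (ListP.∷-injectiveʳ (ListP.∷-injectiveʳ eq))
raiseAllValleys-NoFFRR (f ∷ r ∷ p) (_ ∷ _ ∷ xs , ys , eq) =
  raiseAllValleys-NoFFRR p (xs , ys , ListP.∷-injectiveʳ (ListP.∷-injectiveʳ eq))

firstDifference : ∀ p q → length p ≡ length q → p ≢ q →
  Σ ℕ λ i → i ℕ.< length p × heightAt p i ≡ heightAt q i × stepAt p i ≢ stepAt q i
firstDifference []      []      _   p≢q = ⊥-elim (p≢q refl)
firstDifference (s ∷ p) (t ∷ q) len p≢q with s ≟ₛ t
... | no s≢t  = 0 , s≤s z≤n , refl , s≢t
... | yes refl with firstDifference p q (ℕP.suc-injective len) (p≢q ∘ cong (s ∷_))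
...   | i , i<p , same , differ = suc i , s≤s i<p , cong (_+_ (stepValue s)) same , differ

-1≤stepValue : ∀ s → -[1+ 0 ] ≤ stepValue s
-1≤stepValue r = ℤ.-≤+
-1≤stepValue f = ℤP.≤-refl

h-1+2≡h+1 : ∀ h → h + -[1+ 0 ] + + 2 ≡ h + + 1
h-1+2≡h+1 = solve-∀

distinct-steps-below : ∀ h a b → a ≢ b → h + stepValue a ≤ h + stepValue b →
                       a ≡ f × h + stepValue a + + 2 ≡ h + stepValue b
distinct-steps-below h r r a≢b _ = ⊥-elim (a≢b refl)
distinct-steps-below h f f a≢b _ = ⊥-elim (a≢b refl)
distinct-steps-below h r f _   le with +-cancelˡ-≤ h le
... | ()
distinct-steps-below h f r _   _  = refl , h-1+2≡h+1 h

leavesDownward : ∀ p q i → i ℕ.< length p → i ℕ.< length q →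
  heightAt p i ≡ heightAt q i → stepAt p i ≢ stepAt q i → heightAt p (suc i) ≤ heightAt q (suc i) →
  stepAt p i ≡ f × heightAt p (suc i) + + 2 ≤ heightAt q (suc i)
leavesDownward p q i i<p i<q same differ below =
  let falls , gap = distinct-steps-below (heightAt p i) _ _ differ (subst₂ _≤_ hₚ h_q below)
  in falls , ℤP.≤-reflexive (trans (cong (_+ + 2) hₚ) (trans gap (sym h_q)))
  where
    hₚ : heightAt p (suc i) ≡ heightAt p i + stepValue (stepAt p i)
    hₚ = heightAt-suc p i i<p
    h_q : heightAt q (suc i) ≡ heightAt p i + stepValue (stepAt q i)
    h_q = trans (heightAt-suc q i i<q) (cong (_+ stepValue (stepAt q i)) (sym same))

h-1+2≡h+2-1 : ∀ h → h + -[1+ 0 ] + + 2 ≡ h + + 2 + -[1+ 0 ]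
h-1+2≡h+2-1 = solve-∀

-- Along a run of falls of p the gap to q cannot shrink, and both paths end at the same
-- height, so the run ends in a valley of p.
valleyAfterFalls : ∀ {N} p q → length p ≡ N → length q ≡ N → height p ≡ height q →
  ∀ t k → t ℕ.+ suc k ≡ N → stepAt p k ≡ f → heightAt p (suc k) + + 2 ≤ heightAt q (suc k) →
  Σ ℕ λ v → valley p v ≡ true × heightAt p v + + 2 ≤ heightAt q v
valleyAfterFalls p q lenₚ len_q same-end zero k k+1≡N _ gap =
  ⊥-elim (i+2≰i (height q) (subst₂ _≤_ (cong (_+ + 2) (trans (heightAt-beyond p (suc k) p≤) same-end))
                                        (heightAt-beyond q (suc k) q≤) gap))
  where
    p≤ = ℕP.≤-reflexive (trans lenₚ (sym k+1≡N))
    q≤ = ℕP.≤-reflexive (trans len_q (sym k+1≡N))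
valleyAfterFalls p q lenₚ len_q same-end (suc t) k t+k+2≡N falls gap with stepAt p (suc k) in next
... | r = suc k , corner-complete f r p k (falls , next , k+1<p) , gap
  where
    k+1<p = subst (suc k ℕ.<_) (sym lenₚ) (<-of-+suc (suc k) t (trans (ℕP.+-comm (suc k) (suc t)) t+k+2≡N))
... | f = valleyAfterFalls p q lenₚ len_q same-end t (suc k) (trans (ℕP.+-suc t (suc k)) t+k+2≡N) next
            (subst₂ _≤_ (trans (sym (h-1+2≡h+2-1 (heightAt p (suc k)))) (cong (_+ + 2) (sym hₚ))) (sym h_q)
                        (ℤP.+-mono-≤ gap (-1≤stepValue (stepAt q (suc k)))))
  where
    k+1+t≡N = trans (ℕP.+-comm (suc k) (suc t)) t+k+2≡N
    hₚ : heightAt p (suc (suc k)) ≡ heightAt p (suc k) + -[1+ 0 ]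
    hₚ = heightAt-suc-step p (subst (suc k ℕ.<_) (sym lenₚ) (<-of-+suc (suc k) t k+1+t≡N)) next
    h_q = heightAt-suc q (suc k) (subst (suc k ℕ.<_) (sym len_q) (<-of-+suc (suc k) t k+1+t≡N))

valleyBelow : ∀ {N} p q → length p ≡ N → length q ≡ N → height p ≡ height q → p ≺ q →
  Σ ℕ λ v → valley p v ≡ true × heightAt p v + + 2 ≤ heightAt q v
valleyBelow {N} p q lenₚ len_q same-end (p≼q , p≢q) =
  let i , i<p , same , differ = firstDifference p q (trans lenₚ (sym len_q)) p≢q
      falls , gap = leavesDownward p q i i<p (subst (i ℕ.<_) (trans lenₚ (sym len_q)) i<p) same differ (p≼q (suc i))
  in valleyAfterFalls p q lenₚ len_q same-end (N ∸ suc i) i (ℕP.m∸n+n≡m (subst (suc i ℕ.≤_) lenₚ i<p)) falls gap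

≼-antisym : ∀ {p q} → length p ≡ length q → p ≼ q → q ≼ p → p ≡ q
≼-antisym len p≼q q≼p = ≡-from-heightAt _ _ len λ i _ → ℤP.≤-antisym (p≼q i) (q≼p i)

≡ᵇ-true : ∀ {m n} → m ≡ n → (m ℕ.≡ᵇ n) ≡ true
≡ᵇ-true {m} {n} m≡n = Equivalence.to T-≡ (ℕP.≡⇒≡ᵇ m n m≡n)

≡ᵇ-false : ∀ {m n} → m ≢ n → (m ℕ.≡ᵇ n) ≡ false
≡ᵇ-false {m} {n} m≢n with m ℕ.≡ᵇ n in eq
... | false = refl
... | true  = ⊥-elim (m≢n (ℕP.≡ᵇ⇒≡ m n (Equivalence.from T-≡ eq)))

≡ᵇ-mirror : ∀ {N} i k v → i ℕ.+ k ≡ N → (i ℕ.≡ᵇ v) ≡ (k ℕ.+ v ℕ.≡ᵇ N)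
≡ᵇ-mirror {N} i k v i+k≡N with i ℕ.≟ v | k ℕ.+ v ℕ.≟ N
... | yes i≡v  | yes k+v≡N = trans (≡ᵇ-true i≡v) (sym (≡ᵇ-true k+v≡N))
... | no i≢v   | no k+v≢N  = trans (≡ᵇ-false i≢v) (sym (≡ᵇ-false k+v≢N))
... | yes refl | no k+i≢N  = ⊥-elim (k+i≢N (trans (ℕP.+-comm k i) i+k≡N))
... | no i≢v   | yes k+v≡N = ⊥-elim (i≢v (ℕP.+-cancelˡ-≡ k i v (trans (trans (ℕP.+-comm k i) i+k≡N) (sym k+v≡N))))

mirrorPair : ℕ → ℕ → ℕ → Bool
mirrorPair N v j = (j ℕ.≡ᵇ v) ∨ (j ℕ.+ v ℕ.≡ᵇ N)

mirrorPair-mirror : ∀ N v i k → i ℕ.+ k ≡ N → mirrorPair N v i ≡ mirrorPair N v k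
mirrorPair-mirror N v i k i+k≡N =
  trans (cong₂ _∨_ (≡ᵇ-mirror i k v i+k≡N) (sym (≡ᵇ-mirror k i v (trans (ℕP.+-comm k i) i+k≡N))))
        (∨-comm (k ℕ.+ v ℕ.≡ᵇ N) (k ℕ.≡ᵇ v))

mirrorPair-sound : ∀ N v j → mirrorPair N v j ≡ true → j ≡ v ⊎ j ℕ.+ v ≡ N
mirrorPair-sound N v j eq with j ℕ.≡ᵇ v in e₁ | j ℕ.+ v ℕ.≡ᵇ N in e₂
mirrorPair-sound N v j eq | true  | _    = inj₁ (ℕP.≡ᵇ⇒≡ j v (Equivalence.from T-≡ e₁))
mirrorPair-sound N v j eq | false | true = inj₂ (ℕP.≡ᵇ⇒≡ (j ℕ.+ v) N (Equivalence.from T-≡ e₂))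
mirrorPair-sound N v j () | false | false

mirrorPair-self : ∀ N v → mirrorPair N v v ≡ true
mirrorPair-self N v rewrite ≡ᵇ-true {v} refl = refl

∧-≡true-elimʳ : ∀ {a b} → a ∧ b ≡ true → b ≡ true
∧-≡true-elimʳ {true} eq = eq

bump-∧-mono : ∀ a b → bump (a ∧ b) ≤ bump (a ∧ true)
bump-∧-mono true  true  = ℤP.≤-refl
bump-∧-mono true  false = ℤ.+≤+ z≤n
bump-∧-mono false _     = ℤP.≤-refl

raiseValleyPair : ℕ → ℕ → List Step → List Step
raiseValleyPair N v = raiseValleys (mirrorPair N v)

heightAt-pair : ∀ {N z} v → Mirrored N z → ∀ j → j ≡ v ⊎ j ℕ.+ v ≡ N → heightAt z j ≡ heightAt z v
heightAt-pair v z-mir j (inj₁ refl)  = refl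
heightAt-pair v z-mir j (inj₂ j+v≡N) = z-mir j v j+v≡N

module _ {N x} (x-dyck : SymmetricDyck N x) (v : ℕ) where

  private
    W = raiseValleyPair N v x

  raiseValleyPair-symmetricDyck : SymmetricDyck N W
  raiseValleyPair-symmetricDyck = raiseValleys-symmetricDyck (mirrorPair N v) (mirrorPair-mirror N v) x-dyck

  x≺raiseValleyPair : valley x v ≡ true → x ≺ W
  x≺raiseValleyPair v-valley = x≼W , x≢W
    where
      x≼W : x ≼ W
      x≼W i = subst (heightAt x i ≤_) (sym (heightAt-raiseValleys _ x i)) (i≤i+bump _ _)
      x≢W : x ≢ W
      x≢W x≡W = i+2≰i (heightAt x v) (ℤP.≤-reflexive (sym (trans (cong (λ q → heightAt q v) x≡W)
                  (heightAt-raiseValleys-bump _ x v (trans (cong (_∧ mirrorPair N v v) v-valley) (mirrorPair-self N v))))))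

  raiseValleyPair-least : ∀ {z} → SymmetricDyck N z → x ≼ z → heightAt x v + + 2 ≤ heightAt z v → W ≼ z
  raiseValleyPair-least {z} z-dyck x≼z gap i with valley x i ∧ mirrorPair N v i in fires
  ... | false = subst (_≤ heightAt z i) (sym (trans (heightAt-raiseValleys-bump _ x i fires) (ℤP.+-identityʳ _))) (x≼z i)
  ... | true  = subst₂ _≤_ (trans (cong (_+ + 2) (sym (heightAt-pair v (mirrored x-dyck) i inPair)))
                                 (sym (heightAt-raiseValleys-bump _ x i fires)))
                           (sym (heightAt-pair v (mirrored z-dyck) i inPair)) gap
    where inPair = mirrorPair-sound N v i (∧-≡true-elimʳ fires)

  raiseValleyPair-gap : ∀ i → heightAt x i + + 2 ≤ heightAt W i → i ≡ v ⊎ i ℕ.+ v ≡ N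
  raiseValleyPair-gap i gap with valley x i ∧ mirrorPair N v i in fires
  ... | true  = mirrorPair-sound N v i (∧-≡true-elimʳ fires)
  ... | false = ⊥-elim (i+2≰i (heightAt x i)
                  (subst (heightAt x i + + 2 ≤_) (trans (heightAt-raiseValleys-bump _ x i fires) (ℤP.+-identityʳ _)) gap))

  raiseValleyPair-≼-raiseAllValleys : W ≼ raiseAllValleys x
  raiseValleyPair-≼-raiseAllValleys i =
    subst₂ _≤_ (sym (heightAt-raiseValleys _ x i)) (sym (heightAt-raiseValleys _ x i))
           (ℤP.+-monoʳ-≤ (heightAt x i) (bump-∧-mono (valley x i) (mirrorPair N v i)))

raiseValleyPair-covers : ∀ {n x} v → InJ n x → valley x v ≡ true → Covers n x (raiseValleyPair (4 ℕ.* n) v x)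
raiseValleyPair-covers {n} {x} v x∈J v-valley =
  SymmetricDyck⇒InJ {n} (raiseValleyPair-symmetricDyck x-dyck v) , x≺raiseValleyPair x-dyck v v-valley , nothingBetween
  where
    x-dyck = InJ⇒SymmetricDyck {n} x∈J
    nothingBetween : ¬ (Σ (List Step) λ u → InJ n u × x ≺ u × u ≺ raiseValleyPair (4 ℕ.* n) v x)
    nothingBetween (u , u∈J , x≺u , (u≼W , u≢W)) =
      let u-dyck = InJ⇒SymmetricDyck {n} u∈J
          v′ , _ , gap′ = valleyBelow x u (length≡N x-dyck) (length≡N u-dyck)
                                          (trans (height≡0 x-dyck) (sym (height≡0 u-dyck))) x≺u
          inPair = raiseValleyPair-gap x-dyck v v′ (ℤP.≤-trans gap′ (u≼W v′))
          gap = subst₂ _≤_ (cong (_+ + 2) (heightAt-pair v (mirrored x-dyck) v′ inPair))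
                           (heightAt-pair v (mirrored u-dyck) v′ inPair) gap′
          W-dyck = raiseValleyPair-symmetricDyck x-dyck v
      in u≢W (≼-antisym (trans (length≡N u-dyck) (sym (length≡N W-dyck))) u≼W
                        (raiseValleyPair-least x-dyck v u-dyck (proj₁ x≺u) gap))

covers⇒raiseValleyPair : ∀ {n x y} → InJ n x → Covers n x y →
                         Σ ℕ λ v → valley x v ≡ true × y ≡ raiseValleyPair (4 ℕ.* n) v x
covers⇒raiseValleyPair {n} {x} {y} x∈J (y∈J , x≺y , nothingBetween) =
  v , v-valley , W≡y
  where
    x-dyck = InJ⇒SymmetricDyck {n} x∈J
    y-dyck = InJ⇒SymmetricDyck {n} y∈J
    below = valleyBelow x y (length≡N x-dyck) (length≡N y-dyck) (trans (height≡0 x-dyck) (sym (height≡0 y-dyck))) x≺y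
    v = proj₁ below
    v-valley = proj₁ (proj₂ below)
    W = raiseValleyPair (4 ℕ.* n) v x
    W≼y : W ≼ y
    W≼y = raiseValleyPair-least x-dyck v y-dyck (proj₁ x≺y) (proj₂ (proj₂ below))
    W≡y : y ≡ W
    W≡y with ListP.≡-dec _≟ₛ_ W y
    ... | yes W≡y = sym W≡y
    ... | no  W≢y = ⊥-elim (nothingBetween (W , SymmetricDyck⇒InJ {n} (raiseValleyPair-symmetricDyck x-dyck v) ,
                                             x≺raiseValleyPair x-dyck v v-valley , W≼y , W≢y))

raiseAllValleys-isPopUp : ∀ {n x} → InJ n x → IsPopUpOf n x (raiseAllValleys x)
raiseAllValleys-isPopUp {n} {x} x∈J =
  SymmetricDyck⇒InJ {n} (raiseValleys-symmetricDyck _ (λ _ _ _ → refl) x-dyck) , upper , least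
  where
    x-dyck = InJ⇒SymmetricDyck {n} x∈J
    upper : ∀ y → y ≡ x ⊎ Covers n x y → y ≼ raiseAllValleys x
    upper y (inj₁ refl) i = subst (heightAt x i ≤_) (sym (heightAt-raiseValleys _ x i)) (i≤i+bump _ _)
    upper y (inj₂ y-covers) with covers⇒raiseValleyPair {n} x∈J y-covers
    ... | v , _ , refl = raiseValleyPair-≼-raiseAllValleys x-dyck v
    least : ∀ z → InJ n z → (∀ y → y ≡ x ⊎ Covers n x y → y ≼ z) → raiseAllValleys x ≼ z
    least z _ z-upper i with valley x i in fires
    ... | false = subst (_≤ heightAt z i) (sym (trans (heightAt-raiseAllValleys x i fires) (ℤP.+-identityʳ _)))
                        (z-upper x (inj₁ refl) i)
    ... | true  = subst (_≤ heightAt z i) W≡R (z-upper W (inj₂ (raiseValleyPair-covers {n} i x∈J fires)) i)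
      where
        W = raiseValleyPair (4 ℕ.* n) i x
        W≡R : heightAt W i ≡ heightAt (raiseAllValleys x) i
        W≡R = trans (heightAt-raiseValleys-bump _ x i (trans (cong (_∧ _) fires) (mirrorPair-self _ i)))
                    (sym (heightAt-raiseAllValleys x i fires))

join-unique : ∀ {n S m m′} → IsJoin n S m → IsJoin n S m′ → m ≡ m′
join-unique {n} (m∈J , m-upper , m-least) (m′∈J , m′-upper , m′-least) =
  ≼-antisym (trans (length≡N (InJ⇒SymmetricDyck {n} m∈J)) (sym (length≡N (InJ⇒SymmetricDyck {n} m′∈J))))
            (m-least _ m′∈J m′-upper) (m′-least _ m∈J m-upper)

interiorZero⇒valley : ∀ {p} → (∀ i → + 0 ≤ heightAt p i) →
  ∀ i → 0 ℕ.< i → i ℕ.< length p → heightAt p i ≡ + 0 → valley p i ≡ true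
interiorZero⇒valley {p} nonneg (suc k) _ k+1<p h≡0 = corner-complete f r p k (falls , rises , k+1<p)
  where
    falls : stepAt p k ≡ f
    falls with stepAt p k in step
    ... | f = refl
    ... | r = ⊥-elim (i+1+n≢0 0 (nonneg k) (trans (sym (heightAt-suc-step p (ℕP.<-trans (ℕP.n<1+n k) k+1<p) step)) h≡0))
    rises : stepAt p (suc k) ≡ r
    rises with stepAt p (suc k) in step
    ... | r = refl
    ... | f with subst (+ 0 ≤_) (trans (heightAt-suc-step p k+1<p step) (cong (_+ -[1+ 0 ]) h≡0)) (nonneg (suc (suc k)))
    ...   | ()

raiseAllValleys-offAxis : ∀ {x} → (∀ i → + 0 ≤ heightAt x i) →
  ∀ i → 0 ℕ.< i → i ℕ.< length x → heightAt (raiseAllValleys x) i ≢ + 0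
raiseAllValleys-offAxis {x} nonneg i 0<i i<x h≡0 with valley x i in fires
... | true  = i+1+n≢0 1 (nonneg i) (trans (sym (heightAt-raiseAllValleys x i fires)) h≡0)
... | false with trans (sym fires) (interiorZero⇒valley nonneg i 0<i i<x
                   (trans (sym (trans (heightAt-raiseAllValleys x i fires) (ℤP.+-identityʳ _))) h≡0))
...   | ()

2≤4n⇒2<4n : ∀ n → 2 ℕ.≤ 4 ℕ.* n → 2 ℕ.< 4 ℕ.* n
2≤4n⇒2<4n (suc n) _ = ℕP.≤-trans (s≤s (s≤s (s≤s z≤n))) (ℕP.*-monoʳ-≤ 4 (s≤s (z≤n {n})))

-- A peak at height 1 would put the path on the axis at a neighbouring interior point.
1≤heightAt-belowPeak : ∀ {n μ} → SymmetricDyck (4 ℕ.* n) μ → OnlyEndpointsOnAxis n μ →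
                       ∀ k → CornerAt r f μ k → + 1 ≤ heightAt μ k
1≤heightAt-belowPeak {μ = μ} μ-dyck off-axis k corner with heightAt μ k in hₖ | nonneg μ-dyck k
... | + suc _  | _  = ℤ.+≤+ (s≤s z≤n)
... | -[1+ _ ] | ()
1≤heightAt-belowPeak {n} {μ} μ-dyck off-axis zero (rises , falls , 1<μ) | + zero | _ =
  ⊥-elim (off-axis 2 (s≤s z≤n) (2≤4n⇒2<4n n (subst (1 ℕ.<_) (length≡N μ-dyck) 1<μ)) h₂≡0)
  where
    h₂≡0 : heightAt μ 2 ≡ + 0
    h₂≡0 = trans (heightAt-suc-step μ 1<μ falls) (cong (_+ -[1+ 0 ]) (heightAt-suc-step μ (ℕP.<-trans ℕ.z<s 1<μ) rises))
1≤heightAt-belowPeak μ-dyck off-axis (suc j) (_ , _ , j+2<μ) | + zero | _ =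
  ⊥-elim (off-axis (suc j) (s≤s z≤n) (subst (suc j ℕ.<_) (length≡N μ-dyck) (ℕP.<-trans (ℕP.n<1+n (suc j)) j+2<μ)) hₖ)

peak-height≥2 : ∀ {n μ} → SymmetricDyck (4 ℕ.* n) μ → OnlyEndpointsOnAxis n μ →
                ∀ i → peak μ i ≡ true → + 2 ≤ heightAt μ i
peak-height≥2 {n} {μ} μ-dyck off-axis i peak-i with corner-sound r f μ i peak-i
... | k , refl , corner@(rises , _ , k+1<μ) =
  subst (+ 2 ≤_) (sym (heightAt-suc-step μ (ℕP.<-trans (ℕP.n<1+n k) k+1<μ) rises))
        (ℤP.+-monoˡ-≤ (+ 1) (1≤heightAt-belowPeak {n} μ-dyck off-axis k corner))

lowerPeaks-symmetricDyck : ∀ {N μ} → SymmetricDyck N μ → (∀ i → peak μ i ≡ true → + 2 ≤ heightAt μ i) →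
                           SymmetricDyck N (lowerPeaks μ)
lowerPeaks-symmetricDyck {N} {μ} μ-dyck high-peaks = record
  { length≡N = trans (length-lowerPeaks μ) (length≡N μ-dyck)
  ; nonneg   = nonneg-lower
  ; height≡0 = begin
      height (lowerPeaks μ)
        ≡⟨ sym (heightAt-beyond _ N (ℕP.≤-reflexive (trans (length-lowerPeaks μ) (length≡N μ-dyck)))) ⟩
      heightAt (lowerPeaks μ) N                  ≡⟨ sym (ℤP.+-identityʳ _) ⟩
      heightAt (lowerPeaks μ) N + bump false     ≡⟨ cong (λ b → heightAt (lowerPeaks μ) N + bump b) (sym (corner-beyond r f μ N N≥μ)) ⟩
      heightAt (lowerPeaks μ) N + bump (peak μ N) ≡⟨ heightAt-lowerPeaks μ N ⟩
      heightAt μ N                               ≡⟨ heightAt-beyond μ N N≥μ ⟩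
      height μ                                   ≡⟨ height≡0 μ-dyck ⟩
      + 0                                        ∎
  ; mirrored = λ i k i+k≡N → +-cancelʳ-≡ (bump (peak μ i)) _ _ (begin
      heightAt (lowerPeaks μ) i + bump (peak μ i) ≡⟨ heightAt-lowerPeaks μ i ⟩
      heightAt μ i                                ≡⟨ mirrored μ-dyck i k i+k≡N ⟩
      heightAt μ k                                ≡⟨ sym (heightAt-lowerPeaks μ k) ⟩
      heightAt (lowerPeaks μ) k + bump (peak μ k) ≡⟨ cong (λ b → heightAt (lowerPeaks μ) k + bump b)
                                                          (sym (peak-mirror (length≡N μ-dyck) (mirrored μ-dyck) i k i+k≡N)) ⟩
      heightAt (lowerPeaks μ) k + bump (peak μ i) ∎)
  }
  where
    open ≡-Reasoning
    N≥μ = ℕP.≤-reflexive (length≡N μ-dyck)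
    nonneg-lower : ∀ i → + 0 ≤ heightAt (lowerPeaks μ) i
    nonneg-lower i with peak μ i in peak-i
    ... | false = subst (+ 0 ≤_) (trans (sym (heightAt-lowerPeaks-bump μ i peak-i)) (ℤP.+-identityʳ _)) (nonneg μ-dyck i)
    ... | true  = +-cancelˡ-≤ (+ 2) (subst (+ 2 ≤_)
                    (trans (sym (heightAt-lowerPeaks-bump μ i peak-i)) (ℤP.+-comm (heightAt (lowerPeaks μ) i) (+ 2)))
                    (high-peaks i peak-i))

NoFFRR-f∷ : ∀ {μ} → + 0 ≤ heightAt μ 1 → NoFFRR μ → NoFFRR (f ∷ μ)
NoFFRR-f∷ {[]}    _  _       ([] , _ , ())
NoFFRR-f∷ {[]}    _  _       (_ ∷ [] , _ , ())
NoFFRR-f∷ {[]}    _  _       (_ ∷ _ ∷ _ , _ , ())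
NoFFRR-f∷ {r ∷ μ} _  no-ffrr = NoFFRR-∷r no-ffrr
NoFFRR-f∷ {f ∷ μ} ()

NoFinalRise-of-dyck : ∀ {p} → (∀ i → + 0 ≤ heightAt p i) → height p ≡ + 0 → NoFinalRise p
NoFinalRise-of-dyck nonneg h≡0 (xs , refl) =
  i+1+n≢0 0 (subst (+ 0 ≤_) heightAt-xs (nonneg (length xs))) (trans (sym (height-++ xs (r ∷ []))) h≡0)
  where
    heightAt-xs : heightAt (xs ++ r ∷ []) (length xs) ≡ height xs
    heightAt-xs = trans (heightAt-++ˡ xs _ _ ℕP.≤-refl) (heightAt-beyond xs _ ℕP.≤-refl)

mainTheorem19 : (n : ℕ) (μ : List Step) → InJ n μ →
    (InPopImage n μ ⇔ (NoFFRR μ × OnlyEndpointsOnAxis n μ))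
mainTheorem19 n μ μ∈J = mk⇔ image⇒pattern pattern⇒image
  where
    μ-dyck = InJ⇒SymmetricDyck {n} μ∈J

    image⇒pattern : InPopImage n μ → NoFFRR μ × OnlyEndpointsOnAxis n μ
    image⇒pattern (x , x∈J , μ-pop) =
      subst (λ q → NoFFRR q × OnlyEndpointsOnAxis n q) (sym (join-unique {n} μ-pop (raiseAllValleys-isPopUp {n} x∈J)))
            (raiseAllValleys-NoFFRR x ,
             λ i 0<i i<4n → raiseAllValleys-offAxis (nonneg x-dyck) i 0<i (subst (i ℕ.<_) (sym (length≡N x-dyck)) i<4n))
      where x-dyck = InJ⇒SymmetricDyck {n} x∈J

    pattern⇒image : NoFFRR μ × OnlyEndpointsOnAxis n μ → InPopImage n μ
    pattern⇒image (no-ffrr , off-axis) =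
      lowerPeaks μ , lowered∈J ,
      subst (IsPopUpOf n (lowerPeaks μ))
            (raiseAllValleys-lowerPeaks μ (NoFFRR-f∷ (nonneg μ-dyck 1) no-ffrr)
                                          (NoFinalRise-of-dyck (nonneg μ-dyck) (height≡0 μ-dyck)))
            (raiseAllValleys-isPopUp {n} lowered∈J)
      where
        lowered∈J = SymmetricDyck⇒InJ {n} (lowerPeaks-symmetricDyck μ-dyck (peak-height≥2 {n} μ-dyck off-axis))
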